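{- Let $G\in\varepsilon_{23}$ and let $C,C'$ be two cycles of $G$ whose intersection is a path $P_t$ with $t>0$ edges. If both $C,C'$ are of type $2$, or one is of type $2$ and the other of type $3$, then $t$ is odd. If both are of type $3$, then $t$ is even.
   Context: All graphs are finite, simple and connected. An Euler graph is a connected graph all of whose nodes have even degree. A cycle of length $n$ is of type $i$ if $n\equiv i\pmod 4$. $\varepsilon_{23}$ is the class of Euler graphs in which every cycle has length $\equiv 2$ or $\equiv 3\pmod 4$ and which contain at least one cycle of each of the types $2$ and $3$. -}

module Defs where

open import Data.Nat using (ℕ; zero; suc; _+_; _≤_; _<_)
open import Data.Nat.DivMod using (_%_; m%n<n)
open import Data.Fin using (Fin; toℕ; fromℕ<; inject₁) renaming (suc to fsuc)
open import Data.Bool using (Bool; true; false; if_then_else_)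
open import Data.List using (List; map; allFin)
open import Data.Nat.ListAction using (sum)
open import Data.Product using (Σ; ∃; ∃-syntax; _×_; _,_)
open import Data.Sum using (_⊎_)
open import Relation.Binary.PropositionalEquality using (_≡_)
open import Function.Definitions using (Injective)
open import Function.Bundles using (_⇔_)

record Graph (n : ℕ) : Set where
  field
    adj    : Fin n → Fin n → Bool
    sym    : ∀ u v → adj u v ≡ adj v u
    irrefl : ∀ v → adj v v ≡ false
open Graph public

module _ {n : ℕ} (G : Graph n) where

  Adj : Fin n → Fin n → Set
  Adj u v = adj G u v ≡ true

  degree : Fin n → ℕ
  degree v = sum (map (λ u → if adj G v u then 1 else 0) (allFin n))

  data Reach : Fin n → Fin n → Set where
    here : ∀ {v} → Reach v v
    step : ∀ {u v w} → Adj u v → Reach v w → Reach u w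

  Connected : Set
  Connected = ∀ u v → Reach u v

  Euler : Set
  Euler = Connected × (∀ v → degree v % 2 ≡ 0)

next : ∀ {k} → Fin k → Fin k
next {suc k} i = fromℕ< (m%n<n (suc (toℕ i)) (suc k))

record Cycle {n : ℕ} (G : Graph n) (k : ℕ) : Set where
  field
    len≥3  : 3 ≤ k
    vert   : Fin k → Fin n
    inj    : Injective _≡_ _≡_ vert
    edges  : ∀ i → Adj G (vert i) (vert (next i))
open Cycle public

module _ {n : ℕ} {G : Graph n} where

  OnCycle : ∀ {k} → Cycle G k → Fin n → Set
  OnCycle C x = ∃[ i ] vert C i ≡ x

  CycleEdge : ∀ {k} → Cycle G k → Fin n → Fin n → Set
  CycleEdge C u v = ∃[ i ] ((vert C i ≡ u × vert C (next i) ≡ v)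
                          ⊎ (vert C i ≡ v × vert C (next i) ≡ u))

  IntersectionIsPath : ∀ {k k'} → Cycle G k → Cycle G k' → ℕ → Set
  IntersectionIsPath C C' t =
    Σ (Fin (suc t) → Fin n) λ w →
      Injective _≡_ _≡_ w
      × (∀ x → (OnCycle C x × OnCycle C' x) ⇔ (∃[ j ] w j ≡ x))
      × (∀ u v → (CycleEdge C u v × CycleEdge C' u v) ⇔
                 (∃[ j ] ((w (inject₁ j) ≡ u × w (fsuc j) ≡ v)
                         ⊎ (w (inject₁ j) ≡ v × w (fsuc j) ≡ u))))

HasType : ∀ {n k} {G : Graph n} → Cycle G k → ℕ → Set
HasType {k = k} C i = k % 4 ≡ i

InE23 : ∀ {n} → Graph n → Set
InE23 G = Euler G
        × (∀ {k} (C : Cycle G k) → HasType C 2 ⊎ HasType C 3)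
        × (∃[ k ] Σ (Cycle G k) λ C → HasType C 2)
        × (∃[ k ] Σ (Cycle G k) λ C → HasType C 3)

-- If C and C' meet in the path P of t edges, then C is P together with an arc A of
-- length L = |C| − t between the ends of P, and likewise C' = P ∪ A' with |A'| = L'.
-- The interiors of A and A' are disjoint (a common vertex would lie on P), so A ∪ A'
-- is a cycle of length L + L' = |C| + |C'| − 2t; it is not degenerate, since A and A'
-- cannot both be the single edge joining the ends of P, which would then be a common
-- edge outside P. In ε₂₃ this cycle has length ≡ 2 or 3 (mod 4), and reducing
-- |C| + |C'| = L + L' + 2t modulo 4 decides the parity of t.

module Submission where

open import Defs hiding (sym)
open import Data.Nat using (ℕ; zero; suc; _+_; _*_; _∸_; _≤_; _<_; z≤n; s≤s; z<s; NonZero; _%_; _/_)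
open import Data.Nat.Properties
open import Data.Nat.DivMod
open import Data.Nat.Tactic.RingSolver using (solve-∀)
open import Data.Fin using (Fin; toℕ; fromℕ<; inject₁; opposite) renaming (suc to fsuc)
open import Data.Fin.Properties using (toℕ-injective; toℕ-fromℕ<; toℕ-inject₁; toℕ<n; opposite-prop; opposite-involutive)
open import Data.Product using (_×_; _,_; ∃-syntax; proj₁; proj₂)
open import Data.Sum using (_⊎_; inj₁; inj₂)
open import Data.Empty using (⊥; ⊥-elim)
open import Relation.Nullary using (¬_; yes; no; contradiction)
open import Relation.Binary.PropositionalEquality
open import Function.Base using (_∘′_)
open import Function.Bundles using (Equivalence)

-- Arithmetic

toℕ-mod : ∀ x d .{{_ : NonZero d}} → toℕ (x mod d) ≡ x % d
toℕ-mod x d = toℕ-fromℕ< (m%n<n x d)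

%-cong-+ˡ : ∀ {d} .{{_ : NonZero d}} m {a b} → a % d ≡ b % d → (m + a) % d ≡ (m + b) % d
%-cong-+ˡ {d} m {a} {b} a≡b = begin
  (m + a) % d          ≡⟨ %-distribˡ-+ m a d ⟩
  (m % d + a % d) % d  ≡⟨ cong (λ r → (m % d + r) % d) a≡b ⟩
  (m % d + b % d) % d  ≡⟨ %-distribˡ-+ m b d ⟨
  (m + b) % d          ∎
  where open ≡-Reasoning

%-cancel-+ˡ : ∀ {d} .{{_ : NonZero d}} m {a b} → (m + a) % d ≡ (m + b) % d → a % d ≡ b % d
%-cancel-+ˡ {d@(suc e)} m {a} {b} eq = begin
  a % d                  ≡⟨ [m+kn]%n≡m%n a m d ⟨
  (a + m * d) % d        ≡⟨ cong (_% d) (shift m e a) ⟩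
  (m * e + (m + a)) % d  ≡⟨ %-cong-+ˡ (m * e) eq ⟩
  (m * e + (m + b)) % d  ≡⟨ cong (_% d) (shift m e b) ⟨
  (b + m * d) % d        ≡⟨ [m+kn]%n≡m%n b m d ⟩
  b % d                  ∎
  where
  open ≡-Reasoning
  shift : ∀ m e x → x + m * suc e ≡ m * e + (m + x)
  shift = solve-∀

+-%-injective : ∀ {d} .{{_ : NonZero d}} s {i j} → i < d → j < d → (s + i) % d ≡ (s + j) % d → i ≡ j
+-%-injective {d} s {i} {j} i<d j<d eq = begin
  i      ≡⟨ m<n⇒m%n≡m i<d ⟨
  i % d  ≡⟨ %-cancel-+ˡ s eq ⟩
  j % d  ≡⟨ m<n⇒m%n≡m j<d ⟩
  j      ∎
  where open ≡-Reasoning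

-- Writing t = 2 q + r, the doubled part 4 q of 2 t vanishes modulo 4.
sum-%4-parity : ∀ t L L' → ((t + L) + (t + L')) % 4 ≡ ((L + L') % 4 + 2 * (t % 2)) % 4
sum-%4-parity t L L' = begin
  ((t + L) + (t + L')) % 4                    ≡⟨ cong (_% 4) (regroup (m≡m%n+[m/n]*n t 2)) ⟩
  ((L + L') + 2 * (t % 2) + (t / 2) * 4) % 4  ≡⟨ [m+kn]%n≡m%n ((L + L') + 2 * (t % 2)) (t / 2) 4 ⟩
  ((L + L') + 2 * (t % 2)) % 4                ≡⟨ %-distribˡ-+ (L + L') (2 * (t % 2)) 4 ⟩
  ((L + L') % 4 + 2 * (t % 2) % 4) % 4        ≡⟨ cong (λ r → ((L + L') % 4 + r) % 4) (m<n⇒m%n≡m 2r<4) ⟩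
  ((L + L') % 4 + 2 * (t % 2)) % 4            ∎
  where
  open ≡-Reasoning
  2r<4 : 2 * (t % 2) < 4
  2r<4 = *-monoʳ-< 2 (m%n<n t 2)
  shape : ∀ r q L L' → (r + q * 2 + L) + (r + q * 2 + L') ≡ (L + L') + 2 * r + q * 4
  shape = solve-∀
  regroup : t ≡ t % 2 + (t / 2) * 2 → (t + L) + (t + L') ≡ (L + L') + 2 * (t % 2) + (t / 2) * 4
  regroup t≡ = trans (cong (λ x → (x + L) + (x + L')) t≡) (shape (t % 2) (t / 2) L L')

parity-table : ∀ {r s u} → r < 2 → s ≡ 2 ⊎ s ≡ 3 → u ≡ (s + 2 * r) % 4 →
               (u ≡ 0 ⊎ u ≡ 1 → r ≡ 1) × (u ≡ 2 → r ≡ 0)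
parity-table {0} _ (inj₁ refl) refl = (λ { (inj₁ ()) ; (inj₂ ()) }) , λ _ → refl
parity-table {0} _ (inj₂ refl) refl = (λ { (inj₁ ()) ; (inj₂ ()) }) , λ _ → refl
parity-table {1} _ (inj₁ refl) refl = (λ _ → refl) , λ ()
parity-table {1} _ (inj₂ refl) refl = (λ _ → refl) , λ ()
parity-table {suc (suc _)} (s≤s (s≤s ())) _ _

parity-of-overlap : ∀ t L L' {K K'} → t + L ≡ K → t + L' ≡ K' →
    (L + L') % 4 ≡ 2 ⊎ (L + L') % 4 ≡ 3 →
    ((K % 4 ≡ 2 × K' % 4 ≡ 2) → t % 2 ≡ 1)
    × (((K % 4 ≡ 2 × K' % 4 ≡ 3) ⊎ (K % 4 ≡ 3 × K' % 4 ≡ 2)) → t % 2 ≡ 1)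
    × ((K % 4 ≡ 3 × K' % 4 ≡ 3) → t % 2 ≡ 0)
parity-of-overlap t L L' refl refl glued23 =
    (λ (p , q) → odd (inj₁ (sum-%4 p q)))
  , (λ { (inj₁ (p , q)) → odd (inj₂ (sum-%4 p q)) ; (inj₂ (p , q)) → odd (inj₂ (sum-%4 p q)) })
  , (λ (p , q) → even (sum-%4 p q))
  where
  table = parity-table (m%n<n t 2) glued23 (sum-%4-parity t L L')
  odd = proj₁ table
  even = proj₂ table
  sum-%4 : ∀ {a b} → (t + L) % 4 ≡ a → (t + L') % 4 ≡ b → ((t + L) + (t + L')) % 4 ≡ (a + b) % 4
  sum-%4 p q = trans (%-distribˡ-+ (t + L) (t + L') 4) (cong₂ (λ a b → (a + b) % 4) p q)

3≤m+n : ∀ {m n} → 0 < m → 0 < n → (m ≡ 1 → n ≡ 1 → ⊥) → 3 ≤ m + n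
3≤m+n {1}           {1}           _ _ not-both = ⊥-elim (not-both refl refl)
3≤m+n {1}           {suc (suc _)} _ _ _        = s≤s (s≤s (s≤s z≤n))
3≤m+n {suc (suc m)} {suc n}       _ _ _        = s≤s (s≤s (≤-trans (s≤s z≤n) (m≤n+m (suc n) m)))

toℕ-next : ∀ {k} (i : Fin (suc k)) → toℕ (next i) ≡ suc (toℕ i) % suc k
toℕ-next {k} i = toℕ-mod (suc (toℕ i)) (suc k)

next-opposite-next : ∀ {k} (i : Fin (suc k)) → next (opposite (next i)) ≡ opposite i
next-opposite-next {k} i = toℕ-injective (begin
  toℕ (next (opposite (next i)))        ≡⟨ toℕ-next (opposite (next i)) ⟩
  suc (toℕ (opposite (next i))) % suc k ≡⟨ cong (λ x → suc x % suc k) (opposite-prop (next i)) ⟩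
  suc (k ∸ toℕ (next i)) % suc k        ≡⟨ cong (λ x → suc (k ∸ x) % suc k) (toℕ-next i) ⟩
  suc (k ∸ suc (toℕ i) % suc k) % suc k ≡⟨ wrap (≤-pred (toℕ<n i)) ⟩
  k ∸ toℕ i                             ≡⟨ opposite-prop i ⟨
  toℕ (opposite i)                      ∎)
  where
  open ≡-Reasoning
  wrap : ∀ {m} → m ≤ k → suc (k ∸ suc m % suc k) % suc k ≡ k ∸ m
  wrap {m} m≤k with m≤n⇒m<n∨m≡n m≤k
  ... | inj₁ m<k = begin
    suc (k ∸ suc m % suc k) % suc k ≡⟨ cong (λ x → suc (k ∸ x) % suc k) (m<n⇒m%n≡m (s≤s m<k)) ⟩
    suc (k ∸ suc m) % suc k         ≡⟨ cong (_% suc k) (+-∸-assoc 1 m<k) ⟨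
    (k ∸ m) % suc k                 ≡⟨ m≤n⇒m%n≡m (m∸n≤m k m) ⟩
    k ∸ m                           ∎
  ... | inj₂ refl = begin
    suc (m ∸ suc m % suc m) % suc m ≡⟨ cong (λ x → suc (m ∸ x) % suc m) (n%n≡0 (suc m)) ⟩
    suc m % suc m                   ≡⟨ n%n≡0 (suc m) ⟩
    0                               ≡⟨ n∸n≡0 m ⟨
    m ∸ m                           ∎

splice : ∀ {a} {A : Set a} → ℕ → (ℕ → A) → (ℕ → A) → ℕ → A
splice L f g i with i <? L
... | yes _ = f i
... | no _  = g (i ∸ L)

splice-< : ∀ {a} {A : Set a} {L f g i} → i < L → splice {A = A} L f g i ≡ f i
splice-< {L = L} {i = i} i<L with i <? L
... | yes _   = refl
... | no i≮L = contradiction i<L i≮L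

splice-≥ : ∀ {a} {A : Set a} {L f g i} → L ≤ i → splice {A = A} L f g i ≡ g (i ∸ L)
splice-≥ {L = L} {i = i} L≤i with i <? L
... | yes i<L = contradiction L≤i (<⇒≱ i<L)
... | no _    = refl

-- Cycles

Adj-sym : ∀ {n} (G : Graph n) {u v} → Adj G u v → Adj G v u
Adj-sym G {u} {v} uv = trans (Graph.sym G v u) uv

module _ {n} {G : Graph n} where

  module _ {k} {D : Cycle G k} where

    cycleEdge-sym : ∀ {u v} → CycleEdge D u v → CycleEdge D v u
    cycleEdge-sym (i , inj₁ uv) = i , inj₂ uv
    cycleEdge-sym (i , inj₂ vu) = i , inj₁ vu

    cycleEdge⇒Adj : ∀ {u v} → CycleEdge D u v → Adj G u v
    cycleEdge⇒Adj (i , inj₁ (p , q)) = subst₂ (Adj G) p q (edges D i)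
    cycleEdge⇒Adj (i , inj₂ (p , q)) = Adj-sym G (subst₂ (Adj G) p q (edges D i))

    cycleEdge⇒OnCycle : ∀ {u v} → CycleEdge D u v → OnCycle D u
    cycleEdge⇒OnCycle (i , inj₁ (p , _)) = i , p
    cycleEdge⇒OnCycle (i , inj₂ (_ , q)) = next i , q

  fromClosedWalk : ∀ m → 3 ≤ m → (d : ℕ → Fin n) →
                   (∀ i → i < m → Adj G (d i) (d (suc i))) → d m ≡ d 0 →
                   (∀ {i j} → i < m → j < m → d i ≡ d j → i ≡ j) → Cycle G m
  fromClosedWalk m@(suc m-1) 3≤m d adj closed injective = record
    { len≥3 = 3≤m
    ; vert  = λ i → d (toℕ i)
    ; inj   = λ {i} {j} e → toℕ-injective (injective (toℕ<n i) (toℕ<n j) e)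
    ; edges = λ i → subst (Adj G (d (toℕ i))) (d-next i) (adj (toℕ i) (toℕ<n i))
    }
    where
    d-% : ∀ {x} → x ≤ m → d x ≡ d (x % m)
    d-% x≤m with m≤n⇒m<n∨m≡n x≤m
    ... | inj₁ x<m  = cong d (sym (m<n⇒m%n≡m x<m))
    ... | inj₂ refl = trans closed (cong d (sym (n%n≡0 m)))
    d-next : ∀ i → d (suc (toℕ i)) ≡ d (toℕ (next i))
    d-next i = trans (d-% (toℕ<n i)) (cong d (sym (toℕ-next i)))

module Periodic {n} {G : Graph n} {k} (D : Cycle G (suc k)) where

  at : ℕ → Fin n
  at x = vert D (x mod suc k)

  at≡at⇒% : ∀ x y → at x ≡ at y → x % suc k ≡ y % suc k
  at≡at⇒% x y e = begin
    x % suc k          ≡⟨ toℕ-mod x (suc k) ⟨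
    toℕ (x mod suc k)  ≡⟨ cong toℕ (inj D e) ⟩
    toℕ (y mod suc k)  ≡⟨ toℕ-mod y (suc k) ⟩
    y % suc k          ∎
    where open ≡-Reasoning

  %⇒at≡at : ∀ x y → x % suc k ≡ y % suc k → at x ≡ at y
  %⇒at≡at x y e =
    cong (vert D) (toℕ-injective (trans (toℕ-mod x (suc k)) (trans e (sym (toℕ-mod y (suc k))))))

  at-toℕ : ∀ i → at (toℕ i) ≡ vert D i
  at-toℕ i = cong (vert D) (toℕ-injective (trans (toℕ-mod (toℕ i) (suc k)) (m<n⇒m%n≡m (toℕ<n i))))

  at-+-period : ∀ x → at (x + suc k) ≡ at x
  at-+-period x = %⇒at≡at (x + suc k) x ([m+n]%n≡m%n x (suc k))

  at-suc-cong : ∀ {x y} → at x ≡ at y → at (suc x) ≡ at (suc y)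
  at-suc-cong {x} {y} e = %⇒at≡at (suc x) (suc y) (%-cong-+ˡ {suc k} 1 {x} {y} (at≡at⇒% x y e))

  at-suc-cancel : ∀ {x y} → at (suc x) ≡ at (suc y) → at x ≡ at y
  at-suc-cancel {x} {y} e = %⇒at≡at x y (%-cancel-+ˡ {suc k} 1 {x} {y} (at≡at⇒% (suc x) (suc y) e))

  at-injective : ∀ s {i j} → i < suc k → j < suc k → at (s + i) ≡ at (s + j) → i ≡ j
  at-injective s {i} {j} i<k j<k e = +-%-injective {suc k} s i<k j<k (at≡at⇒% (s + i) (s + j) e)

  OnCycle-at : ∀ x → OnCycle D (at x)
  OnCycle-at x = x mod suc k , refl

  cycleEdge-at : ∀ x → CycleEdge D (at x) (at (suc x))
  cycleEdge-at x =
    x mod suc k , inj₁ (refl , %⇒at≡at (suc (toℕ (x mod suc k))) (suc x) (%-cong-+ˡ {suc k} 1 x%k%k≡x%k))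
    where
    x%k%k≡x%k : toℕ (x mod suc k) % suc k ≡ x % suc k
    x%k%k≡x%k = trans (cong (_% suc k) (toℕ-mod x (suc k))) (m%n%n≡m%n x (suc k))

  cycleEdge⇒at : ∀ {u v} → CycleEdge D u v →
                 ∃[ y ] ((at y ≡ u × at (suc y) ≡ v) ⊎ (at y ≡ v × at (suc y) ≡ u))
  cycleEdge⇒at (i , inj₁ (p , q)) = toℕ i , inj₁ (trans (at-toℕ i) p , q)
  cycleEdge⇒at (i , inj₂ (p , q)) = toℕ i , inj₂ (trans (at-toℕ i) p , q)

module _ {n} {G : Graph n} {k} (D : Cycle G (suc k)) where

  reverse : Cycle G (suc k)
  reverse = record
    { len≥3 = len≥3 D
    ; vert  = λ i → vert D (opposite i)
    ; inj   = λ {i} {j} e → begin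
        i                       ≡⟨ opposite-involutive i ⟨
        opposite (opposite i)   ≡⟨ cong opposite (inj D e) ⟩
        opposite (opposite j)   ≡⟨ opposite-involutive j ⟩
        j                       ∎
    ; edges = λ i → Adj-sym G (subst (λ j → Adj G (vert D (opposite (next i))) (vert D j))
                                   (next-opposite-next i) (edges D (opposite (next i))))
    }
    where open ≡-Reasoning

  reverse-step : ∀ {i u v} → vert D i ≡ u → vert D (next i) ≡ v →
                 vert reverse (opposite (next i)) ≡ v × vert reverse (next (opposite (next i))) ≡ u
  reverse-step {i} p q = trans (cong (vert D) (opposite-involutive (next i))) q
                       , trans (cong (vert D ∘′ opposite) (next-opposite-next i))
                               (trans (cong (vert D) (opposite-involutive i)) p)

  cycleEdge-reverse : ∀ {u v} → CycleEdge D u v → CycleEdge reverse u v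
  cycleEdge-reverse (i , inj₁ (p , q)) = opposite (next i) , inj₂ (reverse-step p q)
  cycleEdge-reverse (i , inj₂ (p , q)) = opposite (next i) , inj₁ (reverse-step p q)

  cycleEdge-unreverse : ∀ {u v} → CycleEdge reverse u v → CycleEdge D u v
  cycleEdge-unreverse (i , inj₁ (p , q)) =
    opposite (next i) , inj₂ (q , trans (cong (vert D) (next-opposite-next i)) p)
  cycleEdge-unreverse (i , inj₂ (p , q)) =
    opposite (next i) , inj₁ (q , trans (cong (vert D) (next-opposite-next i)) p)

  OnCycle-unreverse : ∀ {x} → OnCycle reverse x → OnCycle D x
  OnCycle-unreverse (i , p) = opposite i , p

-- Arcs

module _ {n} {G : Graph n} where

  record Arc {k} (D : Cycle G k) (X : Fin n → Set) (u v : Fin n) (L : ℕ) : Set where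
    field
      point        : ℕ → Fin n
      point-0      : point 0 ≡ u
      point-L      : point L ≡ v
      along        : ∀ i → i < L → CycleEdge D (point i) (point (suc i))
      injective    : ∀ {i j} → i ≤ L → j ≤ L → point i ≡ point j → i ≡ j
      inner-avoids : ∀ {i} → 0 < i → i < L → ¬ X (point i)

  module _ {k} {D : Cycle G k} {X u v L} (A : Arc D X u v L) where
    open Arc A

    Arc-map : ∀ {k'} {D' : Cycle G k'} → (∀ {x y} → CycleEdge D x y → CycleEdge D' x y) → Arc D' X u v L
    Arc-map f = record
      { point = point ; point-0 = point-0 ; point-L = point-L
      ; along = λ i i<L → f (along i i<L)
      ; injective = injective ; inner-avoids = inner-avoids
      }

    Arc-reverse : Arc D X v u L
    Arc-reverse = record
      { point        = λ i → point (L ∸ i)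
      ; point-0      = point-L
      ; point-L      = trans (cong point (n∸n≡0 L)) point-0
      ; along        = λ i i<L → subst (λ j → CycleEdge D (point j) (point (L ∸ suc i)))
                                       (sym (+-∸-assoc 1 i<L))
                                       (cycleEdge-sym {D = D} (along (L ∸ suc i) (∸-monoʳ-< z<s i<L)))
      ; injective    = λ {i} {j} i≤L j≤L e → ∸-cancelˡ-≡ i≤L j≤L (injective (m∸n≤m L i) (m∸n≤m L j) e)
      ; inner-avoids = λ {i} 0<i i<L → inner-avoids (m<n⇒0<n∸m i<L) (∸-monoʳ-< 0<i (<⇒≤ i<L))
      }

    Arc-edge : L ≡ 1 → CycleEdge D u v
    Arc-edge refl = subst₂ (CycleEdge D) point-0 point-L (along 0 z<s)

  glue : ∀ {k k'} {C : Cycle G k} {C' : Cycle G k'} {X u v L L'} →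
         Arc C X u v L → Arc C' (OnCycle C) v u L' → 3 ≤ L + L' → Cycle G (L + L')
  glue {C = C} {C'} {u = u} {L = L} {L'} A B 3≤ =
    fromClosedWalk (L + L') 3≤ d adjacent closed injective
    where
    module A = Arc A
    module B = Arc B
    d : ℕ → Fin n
    d = splice L A.point B.point

    d-< : ∀ {i} → i < L → d i ≡ A.point i
    d-< = splice-<

    d-≥ : ∀ {i} → L ≤ i → d i ≡ B.point (i ∸ L)
    d-≥ = splice-≥

    d-≤ : ∀ {i} → i ≤ L → d i ≡ A.point i
    d-≤ {i} i≤L with m≤n⇒m<n∨m≡n i≤L
    ... | inj₁ i<L  = d-< i<L
    ... | inj₂ refl = trans (d-≥ ≤-refl)
                            (trans (cong B.point (n∸n≡0 L)) (trans B.point-0 (sym A.point-L)))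

    offset< : ∀ {i} → L ≤ i → i < L + L' → i ∸ L < L'
    offset< {i} L≤i i<L+L' = +-cancelˡ-< L (i ∸ L) L' (subst (_< L + L') (sym (m+[n∸m]≡n L≤i)) i<L+L')

    adjacent : ∀ i → i < L + L' → Adj G (d i) (d (suc i))
    adjacent i i<L+L' with <-≤-connex i L
    ... | inj₁ i<L = subst₂ (Adj G) (sym (d-≤ (<⇒≤ i<L))) (sym (d-≤ i<L)) (cycleEdge⇒Adj {D = C} (A.along i i<L))
    ... | inj₂ L≤i = subst₂ (Adj G) (sym (d-≥ L≤i))
                           (sym (trans (d-≥ (m≤n⇒m≤1+n L≤i)) (cong B.point (+-∸-assoc 1 L≤i))))
                           (cycleEdge⇒Adj {D = C'} (B.along (i ∸ L) (offset< L≤i i<L+L')))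

    closed : d (L + L') ≡ d 0
    closed = begin
      d (L + L')            ≡⟨ d-≥ (m≤m+n L L') ⟩
      B.point (L + L' ∸ L)  ≡⟨ cong B.point (m+n∸m≡n L L') ⟩
      B.point L'            ≡⟨ B.point-L ⟩
      u                     ≡⟨ A.point-0 ⟨
      A.point 0             ≡⟨ d-≤ z≤n ⟨
      d 0                   ∎
      where open ≡-Reasoning

    -- B.point 0 is A.point L, and the inner vertices of B lie off C
    disjoint : ∀ {i j} → i < L → L ≤ j → j < L + L' → A.point i ≢ B.point (j ∸ L)
    disjoint {i} {j} i<L L≤j j<L+L' e with j ∸ L in eq
    ... | zero  = <-irrefl (A.injective (<⇒≤ i<L) ≤-refl (trans e (trans B.point-0 (sym A.point-L)))) i<L
    ... | suc _ = B.inner-avoids z<s (subst (_< L') eq (offset< L≤j j<L+L'))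
                                 (subst (OnCycle C) e (cycleEdge⇒OnCycle {D = C} (A.along i i<L)))

    injective : ∀ {i j} → i < L + L' → j < L + L' → d i ≡ d j → i ≡ j
    injective {i} {j} i< j< e with <-≤-connex i L | <-≤-connex j L
    ... | inj₁ i<L | inj₁ j<L = A.injective (<⇒≤ i<L) (<⇒≤ j<L)
                                  (trans (sym (d-< i<L)) (trans e (d-< j<L)))
    ... | inj₁ i<L | inj₂ L≤j = ⊥-elim (disjoint i<L L≤j j<
                                  (trans (sym (d-< i<L)) (trans e (d-≥ L≤j))))
    ... | inj₂ L≤i | inj₁ j<L = ⊥-elim (disjoint j<L L≤i i<
                                  (trans (sym (d-< j<L)) (trans (sym e) (d-≥ L≤i))))
    ... | inj₂ L≤i | inj₂ L≤j = begin
      i            ≡⟨ m+[n∸m]≡n L≤i ⟨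
      L + (i ∸ L)  ≡⟨ cong (L +_) (B.injective (<⇒≤ (offset< L≤i i<)) (<⇒≤ (offset< L≤j j<))
                        (trans (sym (d-≥ L≤i)) (trans e (d-≥ L≤j)))) ⟩
      L + (j ∸ L)  ≡⟨ m+[n∸m]≡n L≤j ⟩
      j            ∎
      where open ≡-Reasoning

  record CoveringPath {k} (D : Cycle G (suc k)) (X : Fin n → Set) (t : ℕ) : Set where
    field
      point     : ℕ → Fin n
      injective : ∀ {i j} → i ≤ t → j ≤ t → point i ≡ point j → i ≡ j
      along     : ∀ j → j < t → CycleEdge D (point j) (point (suc j))
      covers    : ∀ {x} → OnCycle D x → X x → ∃[ j ] j ≤ t × point j ≡ x

  module _ {k} {D : Cycle G (suc k)} {X t} (P : CoveringPath D X t) where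
    open CoveringPath P

    CoveringPath-reverse : CoveringPath (reverse D) X t
    CoveringPath-reverse = record
      { point = point ; injective = injective
      ; along = λ j j<t → cycleEdge-reverse D (along j j<t)
      ; covers = λ x∈D → covers (OnCycle-unreverse D x∈D)
      }

    ComplementArc : Set
    ComplementArc = ∃[ L ] t + L ≡ suc k × 0 < L × Arc D X (point t) (point 0) L

  ComplementArc-unreverse : ∀ {k} {D : Cycle G (suc k)} {X t} {P : CoveringPath D X t} →
                            ComplementArc (CoveringPath-reverse P) → ComplementArc P
  ComplementArc-unreverse {D = D} (L , t+L≡k , 0<L , A) = L , t+L≡k , 0<L , Arc-map A (cycleEdge-unreverse D)

  module _ {k} {D : Cycle G (suc k)} {X : Fin n → Set} where
    open Periodic D

    segment : ∀ s L {u v} → L < suc k → at s ≡ u → at (s + L) ≡ v →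
              (∀ {i} → 0 < i → i < L → ¬ X (at (s + i))) → Arc D X u v L
    segment s L L<k s≡ s+L≡ avoids = record
      { point        = λ i → at (s + i)
      ; point-0      = trans (cong at (+-identityʳ s)) s≡
      ; point-L      = s+L≡
      ; along        = λ i _ → subst (λ x → CycleEdge D (at (s + i)) (at x)) (sym (+-suc s i)) (cycleEdge-at (s + i))
      ; injective    = λ i≤L j≤L → at-injective s (≤-<-trans i≤L L<k) (≤-<-trans j≤L L<k)
      ; inner-avoids = avoids
      }

  module _ {k} {D : Cycle G (suc k)} {X t} (0<t : 0 < t) (P : CoveringPath D X t) where
    open CoveringPath P
    open Periodic D

    -- Once the first edge of P is a forward step of D, every edge is: a backward
    -- step would revisit point j.
    forward-steps : ∀ {p} → at p ≡ point 0 → at (suc p) ≡ point 1 →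
                    ∀ j → suc j ≤ t → point j ≡ at (p + j) × point (suc j) ≡ at (p + suc j)
    forward-steps {p} p≡ sp≡ zero _ = trans (sym p≡) (cong at (sym (+-identityʳ p)))
                                    , trans (sym sp≡) (cong at (sym (+-comm p 1)))
    forward-steps {p} p≡ sp≡ (suc j) j+2≤t
      with forward-steps p≡ sp≡ j (<⇒≤ j+2≤t) | cycleEdge⇒at (along (suc j) j+2≤t)
    ... | _ , e | y , inj₁ (y≡ , sy≡) =
          e , trans (sym sy≡) (trans (at-suc-cong (trans y≡ e)) (cong at (sym (+-suc p (suc j)))))
    ... | e₀ , e | y , inj₂ (y≡ , sy≡) = ⊥-elim (<-irrefl (sym revisit) (s≤s (n≤1+n j)))
      where
      revisit : suc (suc j) ≡ j
      revisit = injective j+2≤t (≤-trans (n≤1+n j) (<⇒≤ j+2≤t))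
                  (trans (sym y≡) (trans (at-suc-cancel (trans sy≡ (trans e (cong at (+-suc p j))))) (sym e₀)))

    on-forward-path : ∀ {p} → at p ≡ point 0 → at (suc p) ≡ point 1 → ∀ j → j ≤ t → point j ≡ at (p + j)
    on-forward-path p≡ sp≡ zero    _     = proj₁ (forward-steps p≡ sp≡ 0 0<t)
    on-forward-path p≡ sp≡ (suc j) j+1≤t = proj₂ (forward-steps p≡ sp≡ j j+1≤t)

    -- The rest of D, read on from point t, is the complementary arc back to point 0.
    forward-complement : ∀ {i} → vert D i ≡ point 0 → vert D (next i) ≡ point 1 → ComplementArc P
    forward-complement {i} i≡ ni≡ = L , t+L≡k , m<n⇒0<n∸m t<k , segment (p + t) L L<k start end avoids
      where
      p = toℕ i
      p≡ : at p ≡ point 0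
      p≡ = trans (at-toℕ i) i≡
      on : ∀ j → j ≤ t → point j ≡ at (p + j)
      on = on-forward-path p≡ ni≡

      -- otherwise P would wind once around D and return to point 0
      t<k : t < suc k
      t<k with t <? suc k
      ... | yes t<k = t<k
      ... | no t≮k  = contradiction (injective z≤n k≤t returns) 0≢1+n
        where
        k≤t = ≮⇒≥ t≮k
        returns : point 0 ≡ point (suc k)
        returns = trans (sym p≡) (trans (sym (at-+-period p)) (sym (on (suc k) k≤t)))

      L = suc k ∸ t
      t+L≡k : t + L ≡ suc k
      t+L≡k = m+[n∸m]≡n (<⇒≤ t<k)
      L<k : L < suc k
      L<k = ∸-monoʳ-< 0<t (<⇒≤ t<k)

      start : at (p + t) ≡ point t
      start = sym (on t ≤-refl)
      end : at (p + t + L) ≡ point 0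
      end = trans (cong at (trans (+-assoc p t L) (cong (p +_) t+L≡k))) (trans (at-+-period p) p≡)

      avoids : ∀ {i} → 0 < i → i < L → ¬ X (at (p + t + i))
      avoids {i} 0<i i<L x with covers (OnCycle-at (p + t + i)) x
      ... | j , j≤t , j≡ = <⇒≱ (m<m+n t 0<i) (subst (_≤ t) j≡t+i j≤t)
        where
        j≡t+i : j ≡ t + i
        j≡t+i = at-injective p (≤-<-trans j≤t t<k) (subst (t + i <_) t+L≡k (+-monoʳ-< t i<L))
                  (trans (sym (on j j≤t)) (trans j≡ (cong at (+-assoc p t i))))

  complement : ∀ {k} {D : Cycle G (suc k)} {X t} → 0 < t → (P : CoveringPath D X t) → ComplementArc P
  complement {D = D} 0<t P with CoveringPath.along P 0 0<t
  ... | i , inj₁ (i≡ , ni≡) = forward-complement 0<t P i≡ ni≡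
  ... | i , inj₂ (i≡ , ni≡) = ComplementArc-unreverse {P = P}
          (forward-complement 0<t (CoveringPath-reverse P) (proj₁ (reverse-step D i≡ ni≡)) (proj₂ (reverse-step D i≡ ni≡)))

-- Two cycles meeting in a path

module Intersection {n} {G : Graph n} {k k'} (C : Cycle G (suc k)) (C' : Cycle G (suc k')) {t}
                    (I : IntersectionIsPath C C' t) where

  w : Fin (suc t) → Fin n
  w = proj₁ I

  W : ℕ → Fin n
  W j = w (j mod suc t)

  W-index : ∀ (i : Fin (suc t)) {j} → toℕ i ≡ j → w i ≡ W j
  W-index i refl = cong w (toℕ-injective (sym (trans (toℕ-mod (toℕ i) (suc t)) (m<n⇒m%n≡m (toℕ<n i)))))

  W-injective : ∀ {i j} → i ≤ t → j ≤ t → W i ≡ W j → i ≡ j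
  W-injective {i} {j} i≤t j≤t e = begin
    i                  ≡⟨ m≤n⇒m%n≡m i≤t ⟨
    i % suc t          ≡⟨ toℕ-mod i (suc t) ⟨
    toℕ (i mod suc t)  ≡⟨ cong toℕ (proj₁ (proj₂ I) e) ⟩
    toℕ (j mod suc t)  ≡⟨ toℕ-mod j (suc t) ⟩
    j % suc t          ≡⟨ m≤n⇒m%n≡m j≤t ⟩
    j                  ∎
    where open ≡-Reasoning

  common-vertex : ∀ {x} → OnCycle C x → OnCycle C' x → ∃[ j ] j ≤ t × W j ≡ x
  common-vertex x∈C x∈C' with Equivalence.to (proj₁ (proj₂ (proj₂ I)) _) (x∈C , x∈C')
  ... | j , wj≡x = toℕ j , ≤-pred (toℕ<n j) , trans (sym (W-index j refl)) wj≡x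

  common-edge : ∀ j → j < t → CycleEdge C (W j) (W (suc j)) × CycleEdge C' (W j) (W (suc j))
  common-edge j j<t = Equivalence.from (proj₂ (proj₂ (proj₂ I)) (W j) (W (suc j)))
    (fromℕ< j<t , inj₁ ( W-index (inject₁ (fromℕ< j<t)) (trans (toℕ-inject₁ (fromℕ< j<t)) (toℕ-fromℕ< j<t))
                       , W-index (fsuc (fromℕ< j<t)) (cong suc (toℕ-fromℕ< j<t))))

  shared-on-C : CoveringPath C (OnCycle C') t
  shared-on-C = record
    { point = W ; injective = W-injective
    ; along = λ j j<t → proj₁ (common-edge j j<t)
    ; covers = common-vertex
    }

  shared-on-C' : CoveringPath C' (OnCycle C) t
  shared-on-C' = record
    { point = W ; injective = W-injective
    ; along = λ j j<t → proj₂ (common-edge j j<t)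
    ; covers = λ x∈C' x∈C → common-vertex x∈C x∈C'
    }

  closing-edge-not-common : t + 1 ≡ suc k → CycleEdge C (W t) (W 0) → CycleEdge C' (W t) (W 0) → ⊥
  closing-edge-not-common t+1≡k e e' with Equivalence.to (proj₂ (proj₂ (proj₂ I)) (W t) (W 0)) (e , e')
  ... | j , inj₁ (j≡t , _) =
        <-irrefl (W-injective (<⇒≤ (toℕ<n j)) ≤-refl (trans (sym (W-index _ (toℕ-inject₁ j))) j≡t)) (toℕ<n j)
  ... | j , inj₂ (j≡0 , j+1≡t) = 3≰2 (subst (3 ≤_) (trans (sym t+1≡k) (cong (_+ 1) t≡1)) (len≥3 C))
    where
    3≰2 : ¬ 3 ≤ 2
    3≰2 (s≤s (s≤s ()))
    t≡1 : t ≡ 1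
    t≡1 = trans (sym (W-injective (toℕ<n j) ≤-refl (trans (sym (W-index (fsuc j) refl)) j+1≡t)))
                (cong suc (W-injective (<⇒≤ (toℕ<n j)) z≤n (trans (sym (W-index _ (toℕ-inject₁ j))) j≡0)))

open Intersection using (shared-on-C; shared-on-C'; closing-edge-not-common)

theorem23 : ∀ {n} (G : Graph n) → InE23 G →
    ∀ {k k'} (C : Cycle G k) (C' : Cycle G k') (t : ℕ) → 0 < t →
    IntersectionIsPath C C' t →
    ((HasType C 2 × HasType C' 2) → t % 2 ≡ 1)
    × (((HasType C 2 × HasType C' 3) ⊎ (HasType C 3 × HasType C' 2)) → t % 2 ≡ 1)
    × ((HasType C 3 × HasType C' 3) → t % 2 ≡ 0)
theorem23 G E {zero} C _ _ _ _ with () ← len≥3 C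
theorem23 G E {suc k} {zero} _ C' _ _ _ with () ← len≥3 C'
theorem23 G (_ , cycle-types , _) {suc k} {suc k'} C C' t 0<t I
  with complement 0<t (shared-on-C C C' I) | complement 0<t (shared-on-C' C C' I)
... | L , t+L≡k , 0<L , A | L' , t+L'≡k' , 0<L' , A' =
  parity-of-overlap t L L' t+L≡k t+L'≡k' (cycle-types (glue A (Arc-reverse A') (3≤m+n 0<L 0<L' single-edges)))
  where
  single-edges : L ≡ 1 → L' ≡ 1 → ⊥
  single-edges refl refl = closing-edge-not-common C C' I t+L≡k (Arc-edge A refl) (Arc-edge A' refl)
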